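{- In the theory of states $T_{sta}$: (1) $\mathtt{update}\circ\mathtt{lookup}\equiv\mathrm{id}_{\mathbb{1}}$; (2) every modifier $f:\mathbb{1}\to\mathbb{1}$ satisfies $f\sim\mathrm{id}_{\mathbb{1}}$, every accessor $f:X\to\mathbb{1}$ satisfies $f\equiv\langle\,\rangle_X$, and every accessor $f:\mathbb{1}\to\mathbb{1}$ satisfies $f\equiv\mathrm{id}_{\mathbb{1}}$; (3) for all pure $u_1,u_2:V\to Y$, the equation $u_1\equiv u_2$ is $T_{sta}$-equivalent to $u_1\circ\mathtt{lookup}\equiv u_2\circ\mathtt{lookup}$ and also to $u_1\circ\mathtt{lookup}\circ\mathtt{update}\equiv u_2\circ\mathtt{lookup}\circ\mathtt{update}$; (4) for all pure $u:V\to Y$ and $v:\mathbb{1}\to Y$, the equation $u\equiv v\circ\langle\,\rangle_V$ is $T_{sta}$-equivalent to $u\circ\mathtt{lookup}\equiv v$.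
   Context: Monadic equational logic with constants $L_{eqn,1}$: types and terms generated by a signature of unary operations, terms being composable paths (with identities); a unit type $\mathbb{1}$ with a term $\langle\,\rangle_X:X\to\mathbb{1}$ for each $X$. Rules: $\equiv$ is an equivalence relation; (subs) from $v_1\equiv v_2:Y\to Z$ and $u:X\to Y$ infer $v_1\circ u\equiv v_2\circ u$; (repl) from $v_1\equiv v_2:X\to Y$ and $w:Y\to Z$ infer $w\circ v_1\equiv w\circ v_2$; (unit) every $f:X\to\mathbb{1}$ satisfies $f\equiv\langle\,\rangle_X$. Decorated logic for states $L_{sta}$: its pure part is a logic $L_{sta}^{(0)}$ extending $L_{eqn,1}$, with a distinguished type $V$; its terms are pure (decoration $(0)$). Terms of $L_{sta}$ are composites of pure terms, $\mathtt{lookup}:\mathbb{1}\to V$ (decoration $(1)$, accessor) and $\mathtt{update}:V\to\mathbb{1}$ (decoration $(2)$, modifier); a composite has decoration the maximum; accessors are terms of decoration at most $(1)$; all terms are modifiers. Formulas: strong equations $f\equiv g$ and weak equations $f\sim g$. Rules: for $\equiv$: equivalence, (subs), (repl) for all decorations; for $\sim$: equivalence and (subs) for all decorations, (repl) only when the outer term $w$ is pure; (unit$_\sim$) every $f:X\to\mathbb{1}$ satisfies $f\sim\langle\,\rangle_X$; $f\equiv g$ implies $f\sim g$; (ax) $\mathtt{lookup}\circ\mathtt{update}\sim\mathrm{id}_V$; (eq$_1$) $f_1\sim f_2$ with $f_1,f_2$ accessors implies $f_1\equiv f_2$; (eq$_2$) for $f_1,f_2:X\to Y$, $f_1\sim f_2$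 and $\langle\,\rangle_Y\circ f_1\equiv\langle\,\rangle_Y\circ f_2$ imply $f_1\equiv f_2$; (eq$_3$) for $f_1,f_2:X\to\mathbb{1}$, $\mathtt{lookup}\circ f_1\sim\mathtt{lookup}\circ f_2$ implies $f_1\equiv f_2$; plus the rules of $L_{sta}^{(0)}$ for pure terms. $T_{sta}$ is the theory of $L_{sta}$ generated by a fixed theory $T^{(0)}$ of $L_{sta}^{(0)}$. $\mathrm{Th}(E)$ is the theory generated by $E$, $T+T'$ the theory generated by $T\cup T'$; sets $E_1,E_2$ of formulas are $T$-equivalent if $T+\mathrm{Th}(E_1)=T+\mathrm{Th}(E_2)$. -}

module Defs where

open import Data.Nat using (ℕ; zero; suc; _⊔_; _≤_)
open import Data.Product using (_×_)
open import Data.Sum using (_⊎_)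
open import Relation.Binary.PropositionalEquality using (_≡_)

data Ty (S : Set) : Set where
  base : S → Ty S
  𝟙    : Ty S

-- The decorated logic for states L_sta, over a signature with sorts S,
-- unary operation symbols Op X Y : X → Y, and a distinguished type V.
module Logic {S : Set} (Op : Ty S → Ty S → Set) (V : Ty S) where

  data Atom : Ty S → Ty S → Set where
    op      : ∀ {X Y} → Op X Y → Atom X Y
    ⟨⟩ₐ     : ∀ X → Atom X 𝟙
    lookupₐ : Atom 𝟙 V
    updateₐ : Atom V 𝟙

  data Term : Ty S → Ty S → Set where
    id  : ∀ {X} → Term X X
    _◂_ : ∀ {X Y Z} → Atom Y Z → Term X Y → Term X Z

  infixr 9 _∘_
  _∘_ : ∀ {X Y Z} → Term Y Z → Term X Y → Term X Z
  id      ∘ u = u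
  (a ◂ v) ∘ u = a ◂ (v ∘ u)

  atom : ∀ {X Y} → Atom X Y → Term X Y
  atom a = a ◂ id

  ⟨⟩ : ∀ X → Term X 𝟙
  ⟨⟩ X = atom (⟨⟩ₐ X)

  lookup : Term 𝟙 V
  lookup = atom lookupₐ

  update : Term V 𝟙
  update = atom updateₐ

  -- decorations: (0) pure, (1) accessor, (2) modifier; composite = maximum
  decA : ∀ {X Y} → Atom X Y → ℕ
  decA (op _)   = 0
  decA (⟨⟩ₐ _)  = 0
  decA lookupₐ  = 1
  decA updateₐ  = 2

  dec : ∀ {X Y} → Term X Y → ℕ
  dec id      = 0
  dec (a ◂ v) = decA a ⊔ dec v

  Pure : ∀ {X Y} → Term X Y → Set
  Pure f = dec f ≡ 0

  Accessor : ∀ {X Y} → Term X Y → Set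
  Accessor f = dec f ≤ 1

  infix 4 _≡ₛ_ _∼_
  data Formula : Set where
    _≡ₛ_ : ∀ {X Y} → Term X Y → Term X Y → Formula
    _∼_  : ∀ {X Y} → Term X Y → Term X Y → Formula

  data PureEquation : Formula → Set where
    pureEq : ∀ {X Y} {f g : Term X Y} → Pure f → Pure g → PureEquation (f ≡ₛ g)

  FSet : Set₁
  FSet = Formula → Set

  data Der (E : FSet) : Formula → Set where
    hyp    : ∀ {φ} → E φ → Der E φ
    ≡-refl  : ∀ {X Y} {f : Term X Y} → Der E (f ≡ₛ f)
    ≡-sym   : ∀ {X Y} {f g : Term X Y} → Der E (f ≡ₛ g) → Der E (g ≡ₛ f)
    ≡-trans : ∀ {X Y} {f g h : Term X Y} → Der E (f ≡ₛ g) → Der E (g ≡ₛ h) → Der E (f ≡ₛ h)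
    ≡-subs  : ∀ {X Y Z} {v₁ v₂ : Term Y Z} (u : Term X Y) →
              Der E (v₁ ≡ₛ v₂) → Der E (v₁ ∘ u ≡ₛ v₂ ∘ u)
    ≡-repl  : ∀ {X Y Z} {v₁ v₂ : Term X Y} (w : Term Y Z) →
              Der E (v₁ ≡ₛ v₂) → Der E (w ∘ v₁ ≡ₛ w ∘ v₂)
    ∼-refl  : ∀ {X Y} {f : Term X Y} → Der E (f ∼ f)
    ∼-sym   : ∀ {X Y} {f g : Term X Y} → Der E (f ∼ g) → Der E (g ∼ f)
    ∼-trans : ∀ {X Y} {f g h : Term X Y} → Der E (f ∼ g) → Der E (g ∼ h) → Der E (f ∼ h)
    ∼-subs  : ∀ {X Y Z} {v₁ v₂ : Term Y Z} (u : Term X Y) →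
              Der E (v₁ ∼ v₂) → Der E (v₁ ∘ u ∼ v₂ ∘ u)
    ∼-repl  : ∀ {X Y Z} {v₁ v₂ : Term X Y} (w : Term Y Z) → Pure w →
              Der E (v₁ ∼ v₂) → Der E (w ∘ v₁ ∼ w ∘ v₂)
    unit    : ∀ {X} (f : Term X 𝟙) → Pure f → Der E (f ≡ₛ ⟨⟩ X)
    unit∼   : ∀ {X} (f : Term X 𝟙) → Der E (f ∼ ⟨⟩ X)
    ≡⇒∼     : ∀ {X Y} {f g : Term X Y} → Der E (f ≡ₛ g) → Der E (f ∼ g)
    ax      : Der E (lookup ∘ update ∼ id)
    eq₁     : ∀ {X Y} {f₁ f₂ : Term X Y} → Accessor f₁ → Accessor f₂ →
              Der E (f₁ ∼ f₂) → Der E (f₁ ≡ₛ f₂)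
    eq₂     : ∀ {X Y} {f₁ f₂ : Term X Y} → Der E (f₁ ∼ f₂) →
              Der E (⟨⟩ Y ∘ f₁ ≡ₛ ⟨⟩ Y ∘ f₂) → Der E (f₁ ≡ₛ f₂)
    eq₃     : ∀ {X} {f₁ f₂ : Term X 𝟙} →
              Der E (lookup ∘ f₁ ∼ lookup ∘ f₂) → Der E (f₁ ≡ₛ f₂)

  Th : FSet → FSet
  Th E = Der E

  _+ₜ_ : FSet → FSet → FSet
  T +ₜ T' = Th (λ φ → T φ ⊎ T' φ)

  _≐_ : FSet → FSet → Set
  T ≐ T' = ∀ φ → (T φ → T' φ) × (T' φ → T φ)

  ⟦_⟧ : Formula → FSet
  ⟦ φ ⟧ ψ = ψ ≡ φ

  Equivalent : FSet → FSet → FSet → Set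
  Equivalent T E₁ E₂ = (T +ₜ Th E₁) ≐ (T +ₜ Th E₂)

  Tsta : FSet → FSet
  Tsta T⁰ = Th T⁰

-- The weak axiom lookup ∘ update ∼ id lets a pure u : V → Y absorb the
-- round trip, u ∘ lookup ∘ update ∼ u, and pure terms are accessors, so (eq₁)
-- turns such weak equations between pure terms into strong ones.  Hence any
-- equation in the image of − ∘ lookup (or − ∘ lookup ∘ update) can be pulled
-- back to pure terms on V.  Point (1) is (eq₃) applied to the same axiom, and
-- point (2) is (unit∼) followed by (eq₁).
module Submission where

open import Defs
open import Data.Product using (_×_; _,_)
open import Data.Sum using (_⊎_; inj₁; inj₂; map₂)
open import Data.Nat using (_⊔_; z≤n; s≤s)
open import Data.Nat.Properties using (⊔-assoc)
open import Relation.Binary.PropositionalEquality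
  using (_≡_; refl; sym; trans; cong; subst; subst₂)

module States {S : Set} (Op : Ty S → Ty S → Set) (V : Ty S) where
  open Logic Op V

  ∘-assoc : ∀ {W X Y Z} (f : Term Y Z) (g : Term X Y) (h : Term W X) →
            (f ∘ g) ∘ h ≡ f ∘ (g ∘ h)
  ∘-assoc id      g h = refl
  ∘-assoc (a ◂ f) g h = cong (a ◂_) (∘-assoc f g h)

  ∘-identityʳ : ∀ {X Y} (f : Term X Y) → f ∘ id ≡ f
  ∘-identityʳ id      = refl
  ∘-identityʳ (a ◂ f) = cong (a ◂_) (∘-identityʳ f)

  dec-∘ : ∀ {X Y Z} (f : Term Y Z) (g : Term X Y) → dec (f ∘ g) ≡ dec f ⊔ dec g
  dec-∘ id      g = refl
  dec-∘ (a ◂ f) g =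
    trans (cong (decA a ⊔_) (dec-∘ f g)) (sym (⊔-assoc (decA a) (dec f) (dec g)))

  Pure-∘ : ∀ {X Y Z} (f : Term Y Z) (g : Term X Y) → Pure f → Pure g → Pure (f ∘ g)
  Pure-∘ f g pf pg rewrite dec-∘ f g | pf | pg = refl

  Pure⇒Accessor : ∀ {X Y} (f : Term X Y) → Pure f → Accessor f
  Pure⇒Accessor f pf rewrite pf = z≤n

  _∪_ : FSet → FSet → FSet
  (E ∪ E') φ = E φ ⊎ E' φ

  cut : ∀ {E E' φ} → (∀ {ψ} → E ψ → Der E' ψ) → Der E φ → Der E' φ
  cut k (hyp e)        = k e
  cut k ≡-refl         = ≡-refl
  cut k (≡-sym d)      = ≡-sym (cut k d)
  cut k (≡-trans d e)  = ≡-trans (cut k d) (cut k e)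
  cut k (≡-subs u d)   = ≡-subs u (cut k d)
  cut k (≡-repl w d)   = ≡-repl w (cut k d)
  cut k ∼-refl         = ∼-refl
  cut k (∼-sym d)      = ∼-sym (cut k d)
  cut k (∼-trans d e)  = ∼-trans (cut k d) (cut k e)
  cut k (∼-subs u d)   = ∼-subs u (cut k d)
  cut k (∼-repl w p d) = ∼-repl w p (cut k d)
  cut k (unit f p)     = unit f p
  cut k (unit∼ f)      = unit∼ f
  cut k (≡⇒∼ d)        = ≡⇒∼ (cut k d)
  cut k ax             = ax
  cut k (eq₁ a b d)    = eq₁ a b (cut k d)
  cut k (eq₂ d e)      = eq₂ (cut k d) (cut k e)
  cut k (eq₃ d)        = eq₃ (cut k d)

  weaken : ∀ {E E' φ} → (∀ {ψ} → E ψ → E' ψ) → Der E φ → Der E' φ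
  weaken k = cut (λ e → hyp (k e))

  assumption : ∀ {T φ} → Der (T ∪ ⟦ φ ⟧) φ
  assumption = hyp (inj₂ refl)

  +ₜ-singleton-mono : ∀ {T φ₁ φ₂} → Der (T ∪ ⟦ φ₂ ⟧) φ₁ →
                      ∀ {φ} → (T +ₜ Th ⟦ φ₁ ⟧) φ → (T +ₜ Th ⟦ φ₂ ⟧) φ
  +ₜ-singleton-mono {T} {φ₁} {φ₂} d = cut from-T+φ₁
    where
      from-T+φ₁ : ∀ {ψ} → (T ∪ Th ⟦ φ₁ ⟧) ψ → (T +ₜ Th ⟦ φ₂ ⟧) ψ
      from-T+φ₁ (inj₁ t) = hyp (inj₁ t)
      from-T+φ₁ (inj₂ e) = cut (λ { refl → weaken (map₂ hyp) d }) e

  interderivable⇒Equivalent : ∀ {T φ₁ φ₂} →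
    Der (T ∪ ⟦ φ₂ ⟧) φ₁ → Der (T ∪ ⟦ φ₁ ⟧) φ₂ → Equivalent T ⟦ φ₁ ⟧ ⟦ φ₂ ⟧
  interderivable⇒Equivalent d₁ d₂ _ = +ₜ-singleton-mono d₁ , +ₜ-singleton-mono d₂

  module _ {E : FSet} where

    ≡ₛ-subst : ∀ {X Y} {f f′ g g′ : Term X Y} →
               f ≡ f′ → g ≡ g′ → Der E (f ≡ₛ g) → Der E (f′ ≡ₛ g′)
    ≡ₛ-subst = subst₂ (λ f g → Der E (f ≡ₛ g))

    ∼⇒≡-pure : ∀ {X Y} (f g : Term X Y) → Pure f → Pure g →
               Der E (f ∼ g) → Der E (f ≡ₛ g)
    ∼⇒≡-pure f g pf pg = eq₁ (Pure⇒Accessor f pf) (Pure⇒Accessor g pg)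

    update∘lookup≡id : Der E (update ∘ lookup ≡ₛ id)
    update∘lookup≡id = eq₃ (∼-subs lookup ax)

    endo𝟙∼id : (f : Term 𝟙 𝟙) → Der E (f ∼ id)
    endo𝟙∼id f = ∼-trans (unit∼ f) (∼-sym (unit∼ id))

    accessor≡⟨⟩ : ∀ {X} (f : Term X 𝟙) → Accessor f → Der E (f ≡ₛ ⟨⟩ X)
    accessor≡⟨⟩ f a = eq₁ a z≤n (unit∼ f)

    accessor-endo𝟙≡id : (f : Term 𝟙 𝟙) → Accessor f → Der E (f ≡ₛ id)
    accessor-endo𝟙≡id f a = ≡-trans (accessor≡⟨⟩ f a) (≡-sym (unit id refl))

    pure∘lookup∘update∼pure : ∀ {Y} {u : Term V Y} → Pure u →
                              Der E (u ∘ lookup ∘ update ∼ u)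
    pure∘lookup∘update∼pure {u = u} pu =
      subst (λ t → Der E (u ∘ lookup ∘ update ∼ t)) (∘-identityʳ u) (∼-repl u pu ax)

    ≡-subs-update : ∀ {Y} {u : Term V Y} {v : Term 𝟙 Y} →
                    Der E (u ∘ lookup ≡ₛ v) → Der E (u ∘ lookup ∘ update ≡ₛ v ∘ update)
    ≡-subs-update {u = u} d =
      ≡ₛ-subst (∘-assoc u lookup update) refl (≡-subs update d)

    cancel-lookup∘update : ∀ {Y} {u₁ u₂ : Term V Y} → Pure u₁ → Pure u₂ →
      Der E (u₁ ∘ lookup ∘ update ≡ₛ u₂ ∘ lookup ∘ update) → Der E (u₁ ≡ₛ u₂)
    cancel-lookup∘update {u₁ = u₁} {u₂} p₁ p₂ d = ∼⇒≡-pure u₁ u₂ p₁ p₂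
      (∼-trans (∼-sym (pure∘lookup∘update∼pure p₁))
        (∼-trans (≡⇒∼ d) (pure∘lookup∘update∼pure p₂)))

    cancel-lookup : ∀ {Y} {u₁ u₂ : Term V Y} → Pure u₁ → Pure u₂ →
      Der E (u₁ ∘ lookup ≡ₛ u₂ ∘ lookup) → Der E (u₁ ≡ₛ u₂)
    cancel-lookup {u₂ = u₂} p₁ p₂ d = cancel-lookup∘update p₁ p₂
      (≡ₛ-subst refl (∘-assoc u₂ lookup update) (≡-subs-update d))

    ∘lookup≡⇒factors-through-⟨⟩ : ∀ {Y} {u : Term V Y} {v : Term 𝟙 Y} → Pure u → Pure v →
      Der E (u ∘ lookup ≡ₛ v) → Der E (u ≡ₛ v ∘ ⟨⟩ V)
    ∘lookup≡⇒factors-through-⟨⟩ {u = u} {v} pu pv d =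
      ∼⇒≡-pure u (v ∘ ⟨⟩ V) pu (Pure-∘ v (⟨⟩ V) pv refl)
      (∼-trans (∼-sym (pure∘lookup∘update∼pure pu))
        (∼-trans (≡⇒∼ (≡-subs-update d)) (∼-repl v pv (unit∼ update))))

    factors-through-⟨⟩⇒∘lookup≡ : ∀ {Y} {u : Term V Y} {v : Term 𝟙 Y} →
      Der E (u ≡ₛ v ∘ ⟨⟩ V) → Der E (u ∘ lookup ≡ₛ v)
    factors-through-⟨⟩⇒∘lookup≡ {v = v} d =
      ≡-trans (≡ₛ-subst refl (∘-assoc v (⟨⟩ V) lookup) (≡-subs lookup d))
              (≡ₛ-subst refl (∘-identityʳ v)
                (≡-repl v (accessor-endo𝟙≡id (⟨⟩ V ∘ lookup) (s≤s z≤n))))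

lemmaA1 : {S : Set} (Op : Ty S → Ty S → Set) (V : Ty S)
    → let open Logic Op V in
      (T⁰ : FSet) → (∀ φ → T⁰ φ → PureEquation φ)
    → Tsta T⁰ (update ∘ lookup ≡ₛ id)
    × ((f : Term 𝟙 𝟙) → Tsta T⁰ (f ∼ id))
    × (∀ {X} (f : Term X 𝟙) → Accessor f → Tsta T⁰ (f ≡ₛ ⟨⟩ X))
    × ((f : Term 𝟙 𝟙) → Accessor f → Tsta T⁰ (f ≡ₛ id))
    × (∀ {Y} (u₁ u₂ : Term V Y) → Pure u₁ → Pure u₂
        → Equivalent (Tsta T⁰) ⟦ u₁ ≡ₛ u₂ ⟧ ⟦ u₁ ∘ lookup ≡ₛ u₂ ∘ lookup ⟧
        × Equivalent (Tsta T⁰) ⟦ u₁ ≡ₛ u₂ ⟧ ⟦ u₁ ∘ lookup ∘ update ≡ₛ u₂ ∘ lookup ∘ update ⟧)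
    × (∀ {Y} (u : Term V Y) (v : Term 𝟙 Y) → Pure u → Pure v
        → Equivalent (Tsta T⁰) ⟦ u ≡ₛ v ∘ ⟨⟩ V ⟧ ⟦ u ∘ lookup ≡ₛ v ⟧)
lemmaA1 Op V T⁰ _ =
    update∘lookup≡id , endo𝟙∼id , accessor≡⟨⟩ , accessor-endo𝟙≡id ,
    (λ u₁ u₂ p₁ p₂ →
      interderivable⇒Equivalent (cancel-lookup p₁ p₂ assumption)
                                (≡-subs lookup assumption) ,
      interderivable⇒Equivalent (cancel-lookup∘update p₁ p₂ assumption)
                                (≡-subs (lookup ∘ update) assumption)) ,
    (λ u v pu pv →
      interderivable⇒Equivalent (∘lookup≡⇒factors-through-⟨⟩ pu pv assumption)
                                (factors-through-⟨⟩⇒∘lookup≡ assumption))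
  where
    open Logic Op V
    open States Op V
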